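{- Let $\mathcal{R}$ be a quasi patch graph rewrite system, let $C$ be a graph, let $(P_L,T_L)\xrightarrow{\tau}(P_R,T_R)\in\mathcal{R}^{\approx}$, let $J$ be a patch for context $C$ and match $P_L$, and let $h_L:E_J\to E_{T_L}$ be a fixed adherence map from $J$ to $T_L$. Then a patch $J'$ (for context $C$ and match $P_R$) together with an adherence map $h_R:E_{J'}\to E_{T_R}$ from $J'$ to $T_R$ such that for every $t\in E_{T_R}$ there is a bijection $\sigma:h_R^{ -1}(t)\to h_L^{ -1}(\tau(t))$ with $\ell(e)=\ell(\sigma(e))$ and $\mathrm{cxt}_{h_R}(e)\subseteq \mathrm{cxt}_{h_L}(\sigma(e))$ for all $e\in h_R^{ -1}(t)$, is uniquely determined up to isomorphism. Moreover, such $J'$ and $h_R$ are obtained by the following procedure: for every type edge $t=(t_s\to t_t)\in E_{T_R}$ and every patch edge $j=(j_s\xrightarrow{\alpha}j_t)\in E_J$ with $h_L(j)=\tau(t)=(t^\tau_s\to t^\tau_t)\in E_{T_L}$, exactly one of the following five cases applies, and one adds a new edge $j'$ to $J'$ (new meaning not in $C$, $P_R$ or the part of $J'$ constructed so far) as indicated, setting $h_R(j')=t$: (1) if $\square\notin\{t_s,t_t\}$, add $t_s\xrightarrow{\alpha}t_t$; (2) if $t_s=t^\tau_s=\square$, add $j_s\xrightarrow{\alpha}t_t$; (3) if $t_t=t^\tau_t=\square$, add $t_s\xrightarrow{\alpha}j_t$; (4) if $t_s=t^\tau_t=\square$, add $j_t\xrightarrow{\alpha}t_t$; (5) if $t_t=t^\tau_s=\square$,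 add $t_s\xrightarrow{\alpha}j_s$.
   Context: A graph $G=(V,E,s,t,\ell)$ over a fixed finite nonempty label set $L$ consists of finite sets $V$ (vertices) and $E$ (edges), maps $s,t:E\to V$ and $\ell:E\to L$; $x\xrightarrow{\alpha}y$ denotes an edge with source $x$, target $y$, label $\alpha$. An unlabeled graph is one over a singleton label set. A graph is simple if distinct edges never share source, target and label. Graphs are disjoint if their vertex sets and their edge sets are disjoint. For disjoint edge sets, the union $(V,E,s,t,\ell)\cup(V',E',s',t',\ell')=(V\cup V',E\cup E',s\cup s',t\cup t',\ell\cup\ell')$. A graph renaming $\phi$ for $G$ consists of bijections $\phi_V:V_1\to V_2$, $\phi_E:E_1\to E_2$ with $V_G\subseteq V_1$, $E_G\subseteq E_1$; $\phi(G)$ has vertices $\phi_V(V_G)$, edges $\phi_E(E_G)$, and $s(\phi_E(e))=\phi_V(s_G(e))$, $t(\phi_E(e))=\phi_V(t_G(e))$, $\ell(\phi_E(e))=\ell_G(e)$. Graphs are isomorphic ($G\approx H$) if $H=\phi(G)$ for some renaming $\phi$. Patch: for disjoint graphs $C$ (context) and $M$ (match), a patch is a graph $J$ with $E_J\cap(E_C\cup E_M)=\emptyset$, $V_J=s(E_J)\cup t(E_J)$, and each edge going from $V_C$ to $V_M$, from $V_M$ to $V_C$, or from $V_M$ to $V_M$. The patch composition is $C\cdot_J M=C\cup J\cup M$. A patch type $T$ for a graph $G$ is an unlabeled patch for context the one-vertex graph with vertex $\square$ and match $G$. For a patch $J$ (context $C$, match $M$) and patch type $T$ for $M$, an edge $j_s\xrightarrow{\alpha}j_t\in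 E_J$ adheres to $t_s\to t_t\in E_T$ if $j_s\in V_C\Rightarrow t_s=\square$, $j_s\in V_M\Rightarrow j_s=t_s$, $j_t\in V_C\Rightarrow t_t=\square$, $j_t\in V_M\Rightarrow j_t=t_t$; an adherence map is $f:E_J\to E_T$ with each $e$ adhering to $f(e)$. For an adherence map $h$ and $e\in E_J$: $\mathrm{cxt}_h(e)=\{s(e)\}$ if $s(h(e))=\square$, $=\{t(e)\}$ if $t(h(e))=\square$, and $=\emptyset$ otherwise. A scheme is a pair $(P,T)$ of a graph $P$ (pattern) and a patch type $T$ for $P$. A quasi patch graph rewrite rule $(P_L,T_L)\xrightarrow{\tau}(P_R,T_R)$ is a pair of schemes with a trace function $\tau:E_{T_R}\to E_{T_L}$ such that for all $e\in E_{T_R}$, $\square\in\{s(e),t(e)\}$ implies $\square\in\{s(\tau(e)),t(\tau(e))\}$. Two quasi rules $L_1\xrightarrow{\tau_1}R_1$, $L_2\xrightarrow{\tau_2}R_2$ are isomorphic if there is a graph renaming $\phi$ with $\phi_V(\square)=\square$, $\phi$ mapping the patterns and patch types of $L_1,R_1$ to those of $L_2,R_2$, and $\phi_E\circ\tau_1=\tau_2\circ\phi_E$. A quasi patch graph rewrite system $\mathcal{R}$ is a set of quasi rules, and $\mathcal{R}^{\approx}$ is its closure under rule isomorphism. -}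

module Defs where

open import Data.Nat using (ℕ)
open import Data.Fin using (Fin; zero; suc)
open import Data.List using (List; []; _∷_; [_]; _++_)
open import Data.List.Membership.Propositional using (_∈_; _∉_)
open import Data.Product using (Σ; ∃; _×_; _,_)
open import Data.Sum using (_⊎_)
open import Data.Unit using (⊤; tt)
open import Relation.Nullary using (¬_)
open import Relation.Binary.PropositionalEquality using (_≡_; _≢_)
open import Function using (id)

-- Vertex names and edge names are drawn from the global name space ℕ;
-- finite vertex / edge sets are finite lists of names (read as sets via ∈).

□ : ℕ
□ = 0

record Graph (A : Set) : Set where
  constructor mkGraph
  field
    V   : List ℕ
    E   : List ℕ
    src : ℕ → ℕ
    tgt : ℕ → ℕ
    lab : ℕ → A
open Graph public

IsGraph : {A : Set} → Graph A → Set
IsGraph G = ∀ {e} → e ∈ E G → src G e ∈ V G × tgt G e ∈ V G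

Disjoint : {A B : Set} → Graph A → Graph B → Set
Disjoint G H = (∀ {v} → v ∈ V G → v ∉ V H) × (∀ {e} → e ∈ E G → e ∉ E H)

InjOn : (ℕ → ℕ) → List ℕ → Set
InjOn f xs = ∀ {x y} → x ∈ xs → y ∈ xs → f x ≡ f y → x ≡ y

-- H = φ(G) for a renaming φ = (fV , fE) (bijective on the relevant sets
-- is imposed separately via InjOn)
Renamed : {A : Set} → (ℕ → ℕ) → (ℕ → ℕ) → Graph A → Graph A → Set
Renamed fV fE G H =
  (∀ {v} → v ∈ V G → fV v ∈ V H) × (∀ {w} → w ∈ V H → ∃ λ v → v ∈ V G × fV v ≡ w) ×
  (∀ {e} → e ∈ E G → fE e ∈ E H) × (∀ {d} → d ∈ E H → ∃ λ e → e ∈ E G × fE e ≡ d) ×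
  (∀ {e} → e ∈ E G →
     (src H (fE e) ≡ fV (src G e)) × (tgt H (fE e) ≡ fV (tgt G e)) × (lab H (fE e) ≡ lab G e))

IsPatch : {A B D : Set} → Graph A → Graph B → Graph D → Set
IsPatch C M J =
  Disjoint C M × IsGraph J ×
  (∀ {e} → e ∈ E J → e ∉ E C × e ∉ E M) ×
  (∀ {v} → v ∈ V J → ∃ λ e → e ∈ E J × (src J e ≡ v ⊎ tgt J e ≡ v)) ×
  (∀ {e} → e ∈ E J →
     (src J e ∈ V C × tgt J e ∈ V M) ⊎ (src J e ∈ V M × tgt J e ∈ V C) ⊎
     (src J e ∈ V M × tgt J e ∈ V M))

Box : Graph ⊤
Box = mkGraph [ □ ] [] (λ _ → □) (λ _ → □) (λ _ → tt)

IsPatchType : {A : Set} → Graph A → Graph ⊤ → Set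
IsPatchType G T = IsPatch Box G T

Adheres : {A B D : Set} → Graph A → Graph B → Graph D → Graph ⊤ → ℕ → ℕ → Set
Adheres C M J T e te =
  (src J e ∈ V C → src T te ≡ □) × (src J e ∈ V M → src J e ≡ src T te) ×
  (tgt J e ∈ V C → tgt T te ≡ □) × (tgt J e ∈ V M → tgt J e ≡ tgt T te)

IsAdhMap : {A B D : Set} → Graph A → Graph B → Graph D → Graph ⊤ → (ℕ → ℕ) → Set
IsAdhMap C M J T h = ∀ {e} → e ∈ E J → h e ∈ E T × Adheres C M J T e (h e)

Cxt : {D : Set} → Graph D → Graph ⊤ → (ℕ → ℕ) → ℕ → ℕ → Set
Cxt J T h e v =
  (src T (h e) ≡ □ × v ≡ src J e) ⊎ (src T (h e) ≢ □ × tgt T (h e) ≡ □ × v ≡ tgt J e)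

record QuasiRule (A : Set) : Set where
  constructor mkRule
  field
    PL : Graph A
    TL : Graph ⊤
    PR : Graph A
    TR : Graph ⊤
    τ  : ℕ → ℕ
    PL-graph : IsGraph PL
    PR-graph : IsGraph PR
    TL-type  : IsPatchType PL TL
    TR-type  : IsPatchType PR TR
    τ-into   : ∀ {e} → e ∈ E TR → τ e ∈ E TL
    τ-box    : ∀ {e} → e ∈ E TR → (src TR e ≡ □ ⊎ tgt TR e ≡ □) →
               (src TL (τ e) ≡ □ ⊎ tgt TL (τ e) ≡ □)
open QuasiRule public

allV : {A : Set} → QuasiRule A → List ℕ
allV ρ = V (PL ρ) ++ V (TL ρ) ++ V (PR ρ) ++ V (TR ρ)

allE : {A : Set} → QuasiRule A → List ℕ
allE ρ = E (PL ρ) ++ E (TL ρ) ++ E (PR ρ) ++ E (TR ρ)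

RuleIso : {A : Set} → QuasiRule A → QuasiRule A → Set
RuleIso ρ₁ ρ₂ = Σ (ℕ → ℕ) λ fV → Σ (ℕ → ℕ) λ fE →
  InjOn fV (allV ρ₁) × InjOn fE (allE ρ₁) × fV □ ≡ □ ×
  Renamed fV fE (PL ρ₁) (PL ρ₂) × Renamed fV fE (TL ρ₁) (TL ρ₂) ×
  Renamed fV fE (PR ρ₁) (PR ρ₂) × Renamed fV fE (TR ρ₁) (TR ρ₂) ×
  (∀ {e} → e ∈ E (TR ρ₁) → fE (τ ρ₁ e) ≡ τ ρ₂ (fE e))

InClosure : {A : Set} → (QuasiRule A → Set) → QuasiRule A → Set
InClosure R ρ = Σ (QuasiRule _) λ ρ₀ → R ρ₀ × RuleIso ρ₀ ρ

Pre : {D : Set} → Graph D → (ℕ → ℕ) → ℕ → ℕ → Set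
Pre J h t e = e ∈ E J × h e ≡ t

BijBetween : (ℕ → ℕ) → (ℕ → Set) → (ℕ → Set) → Set
BijBetween σ P Q =
  (∀ {x} → P x → Q (σ x)) × (∀ {x y} → P x → P y → σ x ≡ σ y → x ≡ y) ×
  (∀ {y} → Q y → ∃ λ x → P x × σ x ≡ y)

Good : {A : Set} → Graph A → QuasiRule A → Graph A → (ℕ → ℕ) → Graph A → (ℕ → ℕ) → Set
Good C ρ J hL J' hR =
  IsPatch C (PR ρ) J' × IsAdhMap C (PR ρ) J' (TR ρ) hR ×
  (∀ {t} → t ∈ E (TR ρ) → Σ (ℕ → ℕ) λ σ →
     BijBetween σ (Pre J' hR t) (Pre J hL (τ ρ t)) ×
     (∀ {e} → Pre J' hR t e →
        (lab J' e ≡ lab J (σ e)) ×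
        (∀ v → Cxt J' (TR ρ) hR e v → Cxt J (TL ρ) hL (σ e) v)))

-- isomorphism of (J₁ , h₁) and (J₂ , h₂) as patches over the fixed C and P_R:
-- a renaming that is the identity on vertices and commutes with the adherence maps
PatchIso : {A : Set} → Graph A → (ℕ → ℕ) → Graph A → (ℕ → ℕ) → Set
PatchIso J₁ h₁ J₂ h₂ = Σ (ℕ → ℕ) λ fE →
  InjOn fE (E J₁) × Renamed id fE J₁ J₂ × (∀ {e} → e ∈ E J₁ → h₂ (fE e) ≡ h₁ e)

CaseCond : {A : Set} → QuasiRule A → ℕ → Fin 5 → Set
CaseCond ρ t zero = src (TR ρ) t ≢ □ × tgt (TR ρ) t ≢ □
CaseCond ρ t (suc zero) = src (TR ρ) t ≡ □ × src (TL ρ) (τ ρ t) ≡ □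
CaseCond ρ t (suc (suc zero)) = tgt (TR ρ) t ≡ □ × tgt (TL ρ) (τ ρ t) ≡ □
CaseCond ρ t (suc (suc (suc zero))) = src (TR ρ) t ≡ □ × tgt (TL ρ) (τ ρ t) ≡ □
CaseCond ρ t (suc (suc (suc (suc zero)))) = tgt (TR ρ) t ≡ □ × src (TL ρ) (τ ρ t) ≡ □

CaseEnds : {A : Set} → QuasiRule A → Graph A → ℕ → ℕ → Fin 5 → ℕ × ℕ
CaseEnds ρ J t j zero = src (TR ρ) t , tgt (TR ρ) t
CaseEnds ρ J t j (suc zero) = src J j , tgt (TR ρ) t
CaseEnds ρ J t j (suc (suc zero)) = src (TR ρ) t , tgt J j
CaseEnds ρ J t j (suc (suc (suc zero))) = tgt J j , tgt (TR ρ) t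
CaseEnds ρ J t j (suc (suc (suc (suc zero)))) = src (TR ρ) t , src J j

ExactlyOne : (Fin 5 → Set) → Set
ExactlyOne P = Σ (Fin 5) λ i → P i × (∀ k → P k → k ≡ i)

Pair : {A : Set} → QuasiRule A → Graph A → (ℕ → ℕ) → ℕ → ℕ → Set
Pair ρ J hL t j = t ∈ E (TR ρ) × j ∈ E J × hL j ≡ τ ρ t

-- (J' , h_R) is an output of the procedure, g t j being the new edge j'
-- added for the pair (t , j)
ProcOutput : {A : Set} → Graph A → QuasiRule A → Graph A → (ℕ → ℕ) →
             Graph A → (ℕ → ℕ) → (ℕ → ℕ → ℕ) → Set
ProcOutput C ρ J hL J' hR g =
  (∀ {d} → d ∈ E J' → ∃ λ t → ∃ λ j → Pair ρ J hL t j × g t j ≡ d) ×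
  (∀ {v} → v ∈ V J' → ∃ λ e → e ∈ E J' × (src J' e ≡ v ⊎ tgt J' e ≡ v)) ×
  (∀ {t j} → Pair ρ J hL t j →
     (g t j ∈ E J') × (g t j ∉ E C) × (g t j ∉ E (PR ρ)) ×
     (src J' (g t j) ∈ V J') × (tgt J' (g t j) ∈ V J') ×
     (hR (g t j) ≡ t) × (lab J' (g t j) ≡ lab J j) ×
     (∀ i → CaseCond ρ t i → (src J' (g t j) , tgt J' (g t j)) ≡ CaseEnds ρ J t j i)) ×
  (∀ {t j t' j'} → Pair ρ J hL t j → Pair ρ J hL t' j' → g t j ≡ g t' j' → (t ≡ t' × j ≡ j'))

module Submission where

open import Defs
open import Data.Nat using (ℕ; suc; pred; _≟_; _+_; _*_; _<_; s≤s)
open import Data.Nat.Properties using (<-irrefl; ≤-trans; m≤m+n; m≤n+m)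
open import Data.Nat.DivMod
  using (_/_; _%_; [m+kn]%n≡m%n; m<n⇒m%n≡m; m<n⇒m/n≡0; m*n/n≡m; +-distrib-/-∣ʳ)
open import Data.Nat.Divisibility using (n∣m*n)
open import Data.Fin using (Fin; zero; suc)
open import Data.List using (List; _++_; map; filter; cartesianProduct)
open import Data.List.Extrema.Nat using (max; xs≤max)
open import Data.List.Membership.Propositional using (_∈_; _∉_; lose)
open import Data.List.Membership.Propositional.Properties
  using (∈-map⁺; ∈-map⁻; ∈-++⁺ˡ; ∈-++⁺ʳ; ∈-++⁻; ∈-filter⁺; ∈-filter⁻;
         ∈-cartesianProduct⁺; ∈-cartesianProduct⁻; ∈-lookup)
open import Data.List.Membership.DecPropositional _≟_ using (_∈?_)
open import Data.List.Relation.Unary.All as All using ()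
open import Data.List.Relation.Unary.Any as Any using (here; any?)
open import Data.List.Relation.Unary.Any.Properties using (lookup-result)
open import Data.Product using (Σ; ∃; _×_; _,_; proj₁; proj₂)
open import Data.Sum using (_⊎_; inj₁; inj₂)
open import Data.Unit using (⊤)
open import Data.Empty using (⊥; ⊥-elim)
open import Function using (_∘_)
open import Relation.Nullary using (yes; no)
open import Relation.Nullary.Decidable using (_×-dec_)
open import Relation.Unary using (Decidable)
open import Relation.Binary.PropositionalEquality
  using (_≡_; _≢_; refl; sym; trans; cong; cong₂; subst; module ≡-Reasoning)

-- Fix a type edge t of T_R and a patch edge j of J with h_L(j) = τ(t).
-- Since T_R is a patch type, at most one end of t is □, and by τ-box the
-- end of τ(t) at □ (if any) is determined; this is the five-case analysis.
-- An edge e of J' "realises" (t , j) when each of its ends is forced the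
-- way the cases prescribe: an end at □ of t must be a context vertex lying
-- in cxt(j) -- a set with at most one element -- and any other end must be
-- the corresponding end of t; moreover e carries the label of j.
-- Hence two realisations of (t , j) have equal ends and labels, and every
-- realisation is a patch edge adhering to t whose cxt lies inside cxt(j).
--   * uniqueness: in a good pair each edge e realises (h_R e , σ(e)); two
--     good pairs are matched edge by edge through their σ's (FibreMatching),
--     and matched edges agree; vertices agree since they are edge ends;
--   * a procedure output is good: the edge added for (t , j) realises it;
--   * existence: the procedure is run with explicitly fresh edge names.

-- the first element of xs satisfying a decidable predicate (0 if none does)
first : {P : ℕ → Set} → Decidable P → List ℕ → ℕ
first P? xs with any? P? xs
... | yes p = Any.lookup p
... | no _ = 0

first-spec : {P : ℕ → Set} (P? : Decidable P) {xs : List ℕ} {x : ℕ} →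
             x ∈ xs → P x → first P? xs ∈ xs × P (first P? xs)
first-spec P? {xs} x∈ px with any? P? xs
... | yes p = ∈-lookup (Any.index p) , lookup-result p
... | no none = ⊥-elim (none (lose x∈ px))

choose : (xs : List ℕ) (Q : ℕ → (ℕ → ℕ) → Set) →
         (∀ {t} → t ∈ xs → Σ (ℕ → ℕ) (Q t)) →
         Σ (ℕ → ℕ → ℕ) λ σ → ∀ {t} → t ∈ xs → Q t (σ t)
choose xs Q witness = σ , σ-ok
  where
  σ : ℕ → ℕ → ℕ
  σ t with t ∈? xs
  ... | yes t∈ = proj₁ (witness t∈)
  ... | no _ = λ _ → 0
  σ-ok : ∀ {t} → t ∈ xs → Q t (σ t)
  σ-ok {t} t∈ with t ∈? xs
  ... | yes t∈′ = proj₂ (witness t∈′)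
  ... | no t∉ = ⊥-elim (t∉ t∈)

Shape : {A B : Set} → Graph A → Graph B → ℕ → ℕ → Set
Shape C M v w = (v ∈ V C × w ∈ V M) ⊎ (v ∈ V M × w ∈ V C) ⊎ (v ∈ V M × w ∈ V M)

Covered : {D : Set} → Graph D → Set
Covered J = ∀ {v} → v ∈ V J → ∃ λ e → e ∈ E J × (src J e ≡ v ⊎ tgt J e ≡ v)

module Patch {A B D : Set} (C : Graph A) (M : Graph B) (J : Graph D) (J-patch : IsPatch C M J) where

  disjoint : Disjoint C M
  disjoint = proj₁ J-patch

  graph : IsGraph J
  graph = proj₁ (proj₂ J-patch)

  covered : Covered J
  covered = proj₁ (proj₂ (proj₂ (proj₂ J-patch)))

  shape : ∀ {e} → e ∈ E J → Shape C M (src J e) (tgt J e)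
  shape = proj₂ (proj₂ (proj₂ (proj₂ J-patch)))

box-vertex : ∀ {x} → x ∈ V Box → x ≡ □
box-vertex (here x≡□) = x≡□

module PatchType {A : Set} (P : Graph A) (T : Graph ⊤) (T-type : IsPatchType P T) where
  open Patch Box P T T-type

  pattern-≢□ : ∀ {x} → x ∈ V P → x ≢ □
  pattern-≢□ x∈P x≡□ = proj₁ disjoint (here x≡□) x∈P

  not-both-□ : ∀ {t} → t ∈ E T → src T t ≡ □ → tgt T t ≡ □ → ⊥
  not-both-□ t∈ s□ t□ with shape t∈
  ... | inj₁ (_ , tP) = pattern-≢□ tP t□
  ... | inj₂ (inj₁ (sP , _)) = pattern-≢□ sP s□
  ... | inj₂ (inj₂ (sP , _)) = pattern-≢□ sP s□

  src-in-pattern : ∀ {t} → t ∈ E T → src T t ≢ □ → src T t ∈ V P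
  src-in-pattern t∈ s≢□ with shape t∈
  ... | inj₁ (s□ , _) = ⊥-elim (s≢□ (box-vertex s□))
  ... | inj₂ (inj₁ (sP , _)) = sP
  ... | inj₂ (inj₂ (sP , _)) = sP

  tgt-in-pattern : ∀ {t} → t ∈ E T → tgt T t ≢ □ → tgt T t ∈ V P
  tgt-in-pattern t∈ t≢□ with shape t∈
  ... | inj₁ (_ , tP) = tP
  ... | inj₂ (inj₁ (_ , t□)) = ⊥-elim (t≢□ (box-vertex t□))
  ... | inj₂ (inj₂ (_ , tP)) = tP

module Adherence {A B D : Set} (C : Graph A) (M : Graph B) (J : Graph D) (T : Graph ⊤)
                 (h : ℕ → ℕ) (M-type : IsPatchType M T) (J-patch : IsPatch C M J)
                 (h-adh : IsAdhMap C M J T h) where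
  open PatchType M T M-type
  open Patch C M J J-patch using (shape)

  src-side : ∀ {e} → e ∈ E J → src J e ∈ V C ⊎ src J e ∈ V M
  src-side e∈ with shape e∈
  ... | inj₁ (sC , _) = inj₁ sC
  ... | inj₂ (inj₁ (sM , _)) = inj₂ sM
  ... | inj₂ (inj₂ (sM , _)) = inj₂ sM

  tgt-side : ∀ {e} → e ∈ E J → tgt J e ∈ V C ⊎ tgt J e ∈ V M
  tgt-side e∈ with shape e∈
  ... | inj₁ (_ , tM) = inj₂ tM
  ... | inj₂ (inj₁ (_ , tC)) = inj₁ tC
  ... | inj₂ (inj₂ (_ , tM)) = inj₂ tM

  src-in-context : ∀ {e} → e ∈ E J → src T (h e) ≡ □ → src J e ∈ V C
  src-in-context e∈ s□ with src-side e∈ | h-adh e∈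
  ... | inj₁ sC | _ = sC
  ... | inj₂ sM | _ , _ , on-src , _ = ⊥-elim (pattern-≢□ sM (trans (on-src sM) s□))

  tgt-in-context : ∀ {e} → e ∈ E J → tgt T (h e) ≡ □ → tgt J e ∈ V C
  tgt-in-context e∈ t□ with tgt-side e∈ | h-adh e∈
  ... | inj₁ tC | _ = tC
  ... | inj₂ tM | _ , _ , _ , _ , on-tgt = ⊥-elim (pattern-≢□ tM (trans (on-tgt tM) t□))

  src-on-type : ∀ {e} → e ∈ E J → src T (h e) ≢ □ → src J e ≡ src T (h e)
  src-on-type e∈ s≢□ with src-side e∈ | h-adh e∈
  ... | inj₁ sC | _ , at-src , _ = ⊥-elim (s≢□ (at-src sC))
  ... | inj₂ sM | _ , _ , on-src , _ = on-src sM

  tgt-on-type : ∀ {e} → e ∈ E J → tgt T (h e) ≢ □ → tgt J e ≡ tgt T (h e)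
  tgt-on-type e∈ t≢□ with tgt-side e∈ | h-adh e∈
  ... | inj₁ tC | _ , _ , _ , at-tgt , _ = ⊥-elim (t≢□ (at-tgt tC))
  ... | inj₂ tM | _ , _ , _ , _ , on-tgt = on-tgt tM

cxt-functional : {D : Set} (J : Graph D) (T : Graph ⊤) (h : ℕ → ℕ) (e : ℕ) {v w : ℕ} →
                 Cxt J T h e v → Cxt J T h e w → v ≡ w
cxt-functional _ _ _ _ (inj₁ (_ , v≡)) (inj₁ (_ , w≡)) = trans v≡ (sym w≡)
cxt-functional _ _ _ _ (inj₁ (s□ , _)) (inj₂ (s≢□ , _)) = ⊥-elim (s≢□ s□)
cxt-functional _ _ _ _ (inj₂ (s≢□ , _)) (inj₁ (s□ , _)) = ⊥-elim (s≢□ s□)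
cxt-functional _ _ _ _ (inj₂ (_ , _ , v≡)) (inj₂ (_ , _ , w≡)) = trans v≡ (sym w≡)

module Cases {A : Set} (ρ : QuasiRule A) where
  private
    module R = PatchType (PR ρ) (TR ρ) (TR-type ρ)
    module L = PatchType (PL ρ) (TL ρ) (TL-type ρ)

  caseOf : ℕ → Fin 5
  caseOf t with src (TR ρ) t ≟ □ | tgt (TR ρ) t ≟ □ | src (TL ρ) (τ ρ t) ≟ □
  ... | no _  | no _  | _     = zero
  ... | yes _ | _     | yes _ = suc zero
  ... | no _  | yes _ | no _  = suc (suc zero)
  ... | yes _ | _     | no _  = suc (suc (suc zero))
  ... | no _  | yes _ | yes _ = suc (suc (suc (suc zero)))

  τ-ends-at-□ : ∀ {t} → t ∈ E (TR ρ) → src (TR ρ) t ≡ □ ⊎ tgt (TR ρ) t ≡ □ →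
                src (TL ρ) (τ ρ t) ≢ □ → tgt (TL ρ) (τ ρ t) ≡ □
  τ-ends-at-□ t∈ at-□ τs≢□ with τ-box ρ t∈ at-□
  ... | inj₁ τs□ = ⊥-elim (τs≢□ τs□)
  ... | inj₂ τt□ = τt□

  caseOf-holds : ∀ {t} → t ∈ E (TR ρ) → CaseCond ρ t (caseOf t)
  caseOf-holds {t} t∈ with src (TR ρ) t ≟ □ | tgt (TR ρ) t ≟ □ | src (TL ρ) (τ ρ t) ≟ □
  ... | no s≢□ | no t≢□ | _ = s≢□ , t≢□
  ... | yes s□ | yes t□ | _ = ⊥-elim (R.not-both-□ t∈ s□ t□)
  ... | yes s□ | no _  | yes τs□ = s□ , τs□
  ... | no _  | yes t□ | yes τs□ = t□ , τs□
  ... | yes s□ | no _  | no τs≢□ = s□ , τ-ends-at-□ t∈ (inj₁ s□) τs≢□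
  ... | no _  | yes t□ | no τs≢□ = t□ , τ-ends-at-□ t∈ (inj₂ t□) τs≢□

  -- two cases never apply together: they would force both ends of t, or
  -- both ends of τ(t), to be □
  case-unique : ∀ {t} → t ∈ E (TR ρ) → ∀ i k → CaseCond ρ t i → CaseCond ρ t k → i ≡ k
  case-unique {t} t∈ = unique
    where
    both-R : src (TR ρ) t ≡ □ → tgt (TR ρ) t ≡ □ → ∀ {i k : Fin 5} → i ≡ k
    both-R s□ t□ = ⊥-elim (R.not-both-□ t∈ s□ t□)
    both-L : src (TL ρ) (τ ρ t) ≡ □ → tgt (TL ρ) (τ ρ t) ≡ □ → ∀ {i k : Fin 5} → i ≡ k
    both-L s□ t□ = ⊥-elim (L.not-both-□ (τ-into ρ t∈) s□ t□)
    unique : ∀ i k → CaseCond ρ t i → CaseCond ρ t k → i ≡ k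
    unique zero zero _ _ = refl
    unique zero (suc zero) (s≢□ , _) (s□ , _) = ⊥-elim (s≢□ s□)
    unique zero (suc (suc zero)) (_ , t≢□) (t□ , _) = ⊥-elim (t≢□ t□)
    unique zero (suc (suc (suc zero))) (s≢□ , _) (s□ , _) = ⊥-elim (s≢□ s□)
    unique zero (suc (suc (suc (suc zero)))) (_ , t≢□) (t□ , _) = ⊥-elim (t≢□ t□)
    unique (suc zero) zero (s□ , _) (s≢□ , _) = ⊥-elim (s≢□ s□)
    unique (suc zero) (suc zero) _ _ = refl
    unique (suc zero) (suc (suc zero)) (s□ , _) (t□ , _) = both-R s□ t□
    unique (suc zero) (suc (suc (suc zero))) (_ , τs□) (_ , τt□) = both-L τs□ τt□
    unique (suc zero) (suc (suc (suc (suc zero)))) (s□ , _) (t□ , _) = both-R s□ t□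
    unique (suc (suc zero)) zero (t□ , _) (_ , t≢□) = ⊥-elim (t≢□ t□)
    unique (suc (suc zero)) (suc zero) (t□ , _) (s□ , _) = both-R s□ t□
    unique (suc (suc zero)) (suc (suc zero)) _ _ = refl
    unique (suc (suc zero)) (suc (suc (suc zero))) (t□ , _) (s□ , _) = both-R s□ t□
    unique (suc (suc zero)) (suc (suc (suc (suc zero)))) (_ , τt□) (_ , τs□) = both-L τs□ τt□
    unique (suc (suc (suc zero))) zero (s□ , _) (s≢□ , _) = ⊥-elim (s≢□ s□)
    unique (suc (suc (suc zero))) (suc zero) (_ , τt□) (_ , τs□) = both-L τs□ τt□
    unique (suc (suc (suc zero))) (suc (suc zero)) (s□ , _) (t□ , _) = both-R s□ t□
    unique (suc (suc (suc zero))) (suc (suc (suc zero))) _ _ = refl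
    unique (suc (suc (suc zero))) (suc (suc (suc (suc zero)))) (s□ , _) (t□ , _) = both-R s□ t□
    unique (suc (suc (suc (suc zero)))) zero (t□ , _) (_ , t≢□) = ⊥-elim (t≢□ t□)
    unique (suc (suc (suc (suc zero)))) (suc zero) (t□ , _) (s□ , _) = both-R s□ t□
    unique (suc (suc (suc (suc zero)))) (suc (suc zero)) (_ , τs□) (_ , τt□) = both-L τs□ τt□
    unique (suc (suc (suc (suc zero)))) (suc (suc (suc zero))) (t□ , _) (s□ , _) = both-R s□ t□
    unique (suc (suc (suc (suc zero)))) (suc (suc (suc (suc zero)))) _ _ = refl

  exactly-one : ∀ {t} → t ∈ E (TR ρ) → ExactlyOne (CaseCond ρ t)
  exactly-one t∈ = caseOf _ , caseOf-holds t∈ ,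
                   λ k c → case-unique t∈ k (caseOf _) c (caseOf-holds t∈)

module Realisation {A : Set} (C : Graph A) (ρ : QuasiRule A) (J : Graph A) (hL : ℕ → ℕ) where
  private
    module R = PatchType (PR ρ) (TR ρ) (TR-type ρ)

  data SrcSpec (t j v : ℕ) : Set where
    via-context : src (TR ρ) t ≡ □ → v ∈ V C → Cxt J (TL ρ) hL j v → SrcSpec t j v
    via-type    : src (TR ρ) t ≢ □ → v ≡ src (TR ρ) t → SrcSpec t j v

  data TgtSpec (t j v : ℕ) : Set where
    via-context : tgt (TR ρ) t ≡ □ → v ∈ V C → Cxt J (TL ρ) hL j v → TgtSpec t j v
    via-type    : tgt (TR ρ) t ≢ □ → v ≡ tgt (TR ρ) t → TgtSpec t j v

  record Realises (J′ : Graph A) (t j e : ℕ) : Set where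
    constructor realisation
    field
      src-spec : SrcSpec t j (src J′ e)
      tgt-spec : TgtSpec t j (tgt J′ e)
      label    : lab J′ e ≡ lab J j

  realises-at : ∀ {J′ t j e v w} → (src J′ e , tgt J′ e) ≡ (v , w) →
                SrcSpec t j v → TgtSpec t j w → lab J′ e ≡ lab J j → Realises J′ t j e
  realises-at refl = realisation

  srcSpec-functional : ∀ {t j v w} → SrcSpec t j v → SrcSpec t j w → v ≡ w
  srcSpec-functional {j = j} (via-context _ _ cv) (via-context _ _ cw) = cxt-functional J (TL ρ) hL j cv cw
  srcSpec-functional (via-context s□ _ _) (via-type s≢□ _) = ⊥-elim (s≢□ s□)
  srcSpec-functional (via-type s≢□ _) (via-context s□ _ _) = ⊥-elim (s≢□ s□)
  srcSpec-functional (via-type _ v≡) (via-type _ w≡) = trans v≡ (sym w≡)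

  tgtSpec-functional : ∀ {t j v w} → TgtSpec t j v → TgtSpec t j w → v ≡ w
  tgtSpec-functional {j = j} (via-context _ _ cv) (via-context _ _ cw) = cxt-functional J (TL ρ) hL j cv cw
  tgtSpec-functional (via-context t□ _ _) (via-type t≢□ _) = ⊥-elim (t≢□ t□)
  tgtSpec-functional (via-type t≢□ _) (via-context t□ _ _) = ⊥-elim (t≢□ t□)
  tgtSpec-functional (via-type _ v≡) (via-type _ w≡) = trans v≡ (sym w≡)

  realisations-agree : ∀ {J₁ J₂ t j e₁ e₂} → Realises J₁ t j e₁ → Realises J₂ t j e₂ →
                       (src J₁ e₁ ≡ src J₂ e₂) × (tgt J₁ e₁ ≡ tgt J₂ e₂) ×
                       (lab J₁ e₁ ≡ lab J₂ e₂)
  realisations-agree (realisation s₁ t₁ l₁) (realisation s₂ t₂ l₂) =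
    srcSpec-functional s₁ s₂ , tgtSpec-functional t₁ t₂ , trans l₁ (sym l₂)

  realiser-cxt : ∀ {J′ t j e v} (hR : ℕ → ℕ) → hR e ≡ t → Realises J′ t j e →
                 Cxt J′ (TR ρ) hR e v → Cxt J (TL ρ) hL j v
  realiser-cxt _ refl (realisation (via-context _ _ c) _ _) (inj₁ (_ , refl)) = c
  realiser-cxt _ refl (realisation (via-type s≢□ _) _ _) (inj₁ (s□ , _)) = ⊥-elim (s≢□ s□)
  realiser-cxt _ refl (realisation _ (via-context _ _ c) _) (inj₂ (_ , _ , refl)) = c
  realiser-cxt _ refl (realisation _ (via-type t≢□ _) _) (inj₂ (_ , t□ , _)) = ⊥-elim (t≢□ t□)

  module _ (C-PR-disjoint : Disjoint C (PR ρ)) where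
    private
      apart : ∀ {v} → v ∈ V C → v ∈ V (PR ρ) → ∀ {X : Set} → X
      apart vC vP = ⊥-elim (proj₁ C-PR-disjoint vC vP)

    srcSpec-side : ∀ {t j v} → t ∈ E (TR ρ) → SrcSpec t j v →
                   (src (TR ρ) t ≡ □ × v ∈ V C) ⊎ v ∈ V (PR ρ)
    srcSpec-side _ (via-context s□ vC _) = inj₁ (s□ , vC)
    srcSpec-side t∈ (via-type s≢□ refl) = inj₂ (R.src-in-pattern t∈ s≢□)

    tgtSpec-side : ∀ {t j v} → t ∈ E (TR ρ) → TgtSpec t j v →
                   (tgt (TR ρ) t ≡ □ × v ∈ V C) ⊎ v ∈ V (PR ρ)
    tgtSpec-side _ (via-context t□ vC _) = inj₁ (t□ , vC)
    tgtSpec-side t∈ (via-type t≢□ refl) = inj₂ (R.tgt-in-pattern t∈ t≢□)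

    srcSpec-adheres : ∀ {t j v} → t ∈ E (TR ρ) → SrcSpec t j v →
                      (v ∈ V C → src (TR ρ) t ≡ □) × (v ∈ V (PR ρ) → v ≡ src (TR ρ) t)
    srcSpec-adheres _ (via-context s□ vC _) = (λ _ → s□) , (λ vP → apart vC vP)
    srcSpec-adheres t∈ (via-type s≢□ refl) =
      (λ vC → apart vC (R.src-in-pattern t∈ s≢□)) , (λ _ → refl)

    tgtSpec-adheres : ∀ {t j v} → t ∈ E (TR ρ) → TgtSpec t j v →
                      (v ∈ V C → tgt (TR ρ) t ≡ □) × (v ∈ V (PR ρ) → v ≡ tgt (TR ρ) t)
    tgtSpec-adheres _ (via-context t□ vC _) = (λ _ → t□) , (λ vP → apart vC vP)
    tgtSpec-adheres t∈ (via-type t≢□ refl) =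
      (λ vC → apart vC (R.tgt-in-pattern t∈ t≢□)) , (λ _ → refl)

    realiser-adheres : ∀ {J′ t j e} → t ∈ E (TR ρ) → Realises J′ t j e →
                       Adheres C (PR ρ) J′ (TR ρ) e t
    realiser-adheres t∈ (realisation sv tw _) =
      let (sC , sP) = srcSpec-adheres t∈ sv ; (tC , tP) = tgtSpec-adheres t∈ tw
      in sC , sP , tC , tP

    realiser-shape : ∀ {J′ t j e} → t ∈ E (TR ρ) → Realises J′ t j e →
                     Shape C (PR ρ) (src J′ e) (tgt J′ e)
    realiser-shape t∈ (realisation sv tw _) with srcSpec-side t∈ sv | tgtSpec-side t∈ tw
    ... | inj₁ (s□ , _) | inj₁ (t□ , _) = ⊥-elim (R.not-both-□ t∈ s□ t□)
    ... | inj₁ (_ , sC) | inj₂ tP = inj₁ (sC , tP)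
    ... | inj₂ sP | inj₁ (_ , tC) = inj₂ (inj₁ (sP , tC))
    ... | inj₂ sP | inj₂ tP = inj₂ (inj₂ (sP , tP))

Matching : {A : Set} → QuasiRule A → Graph A → (ℕ → ℕ) → Graph A → (ℕ → ℕ) →
           ℕ → (ℕ → ℕ) → Set
Matching ρ J hL J′ hR t σ =
  BijBetween σ (Pre J′ hR t) (Pre J hL (τ ρ t)) ×
  (∀ {e} → Pre J′ hR t e →
     (lab J′ e ≡ lab J (σ e)) × (∀ v → Cxt J′ (TR ρ) hR e v → Cxt J (TL ρ) hL (σ e) v))

module GoodPair {A : Set} (C : Graph A) (ρ : QuasiRule A) (J : Graph A) (hL : ℕ → ℕ)
                (J′ : Graph A) (hR : ℕ → ℕ) (good : Good C ρ J hL J′ hR) where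
  open Realisation C ρ J hL
  private
    module R = PatchType (PR ρ) (TR ρ) (TR-type ρ)
    open Adherence C (PR ρ) J′ (TR ρ) hR (TR-type ρ) (proj₁ good) (proj₁ (proj₂ good))
      renaming (src-in-context to src-in-C; tgt-in-context to tgt-in-C)

  type-edge : ∀ {e} → e ∈ E J′ → hR e ∈ E (TR ρ)
  type-edge e∈ = proj₁ (proj₁ (proj₂ good) e∈)

  σ-family : Σ (ℕ → ℕ → ℕ) λ σ → ∀ {t} → t ∈ E (TR ρ) → Matching ρ J hL J′ hR t (σ t)
  σ-family = choose (E (TR ρ)) (Matching ρ J hL J′ hR) (proj₂ (proj₂ good))

  σ : ℕ → ℕ → ℕ
  σ = proj₁ σ-family

  σ-matching : ∀ {t} → t ∈ E (TR ρ) → Matching ρ J hL J′ hR t (σ t)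
  σ-matching = proj₂ σ-family

  σ-bij : ∀ {t} → t ∈ E (TR ρ) → BijBetween (σ t) (Pre J′ hR t) (Pre J hL (τ ρ t))
  σ-bij t∈ = proj₁ (σ-matching t∈)

  realises : ∀ {t e} → Pre J′ hR t e → Realises J′ t (σ t e) e
  realises {e = e} pre@(e∈ , refl) = realisation src-spec tgt-spec (proj₁ (proj₂ (σ-matching t∈) pre))
    where
    t∈ : hR e ∈ E (TR ρ)
    t∈ = type-edge e∈
    cxt-incl : ∀ v → Cxt J′ (TR ρ) hR e v → Cxt J (TL ρ) hL (σ (hR e) e) v
    cxt-incl = proj₂ (proj₂ (σ-matching t∈) pre)
    src-spec : SrcSpec (hR e) (σ (hR e) e) (src J′ e)
    src-spec with src (TR ρ) (hR e) ≟ □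
    ... | yes s□ = via-context s□ (src-in-C e∈ s□) (cxt-incl _ (inj₁ (s□ , refl)))
    ... | no s≢□ = via-type s≢□ (src-on-type e∈ s≢□)
    tgt-spec : TgtSpec (hR e) (σ (hR e) e) (tgt J′ e)
    tgt-spec with tgt (TR ρ) (hR e) ≟ □
    ... | yes t□ = via-context t□ (tgt-in-C e∈ t□)
                     (cxt-incl _ (inj₂ ((λ s□ → R.not-both-□ t∈ s□ t□) , t□ , refl)))
    ... | no t≢□ = via-type t≢□ (tgt-on-type e∈ t≢□)

module _ {σ : ℕ → ℕ} {P Q : ℕ → Set} (b : BijBetween σ P Q) where

  bij-into : ∀ {x} → P x → Q (σ x)
  bij-into = proj₁ b

  bij-injective : ∀ {x y} → P x → P y → σ x ≡ σ y → x ≡ y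
  bij-injective = proj₁ (proj₂ b)

  bij-onto : ∀ {y} → Q y → ∃ λ x → P x × σ x ≡ y
  bij-onto = proj₂ (proj₂ b)

module FibreMatching {D₁ D₂ : Set} (J₁ : Graph D₁) (J₂ : Graph D₂) (h₁ h₂ : ℕ → ℕ)
                     (Ts : List ℕ) (Q : ℕ → ℕ → Set) (σ₁ σ₂ : ℕ → ℕ → ℕ)
                     (h₁-into : ∀ {e} → e ∈ E J₁ → h₁ e ∈ Ts)
                     (h₂-into : ∀ {e} → e ∈ E J₂ → h₂ e ∈ Ts)
                     (bij₁ : ∀ {t} → t ∈ Ts → BijBetween (σ₁ t) (Pre J₁ h₁ t) (Q t))
                     (bij₂ : ∀ {t} → t ∈ Ts → BijBetween (σ₂ t) (Pre J₂ h₂ t) (Q t)) where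
  open ≡-Reasoning

  partner : ℕ → ℕ → ℕ
  partner t e = first (λ x → (h₂ x ≟ t) ×-dec (σ₂ t x ≟ σ₁ t e)) (E J₂)

  partner-spec : ∀ {t e} → t ∈ Ts → Pre J₁ h₁ t e →
                 Pre J₂ h₂ t (partner t e) × σ₂ t (partner t e) ≡ σ₁ t e
  partner-spec {t} {e} t∈ pre with bij-onto (bij₂ t∈) (bij-into (bij₁ t∈) pre)
  ... | x , (x∈ , hx) , σx =
    let (p∈ , hp , σp) = first-spec (λ x → (h₂ x ≟ t) ×-dec (σ₂ t x ≟ σ₁ t e)) x∈ (hx , σx)
    in (p∈ , hp) , σp

  f : ℕ → ℕ
  f e = partner (h₁ e) e

  f-spec : ∀ {e} → e ∈ E J₁ → Pre J₂ h₂ (h₁ e) (f e) × σ₂ (h₁ e) (f e) ≡ σ₁ (h₁ e) e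
  f-spec e∈ = partner-spec (h₁-into e∈) (e∈ , refl)

  f-injective : InjOn f (E J₁)
  f-injective {x} {y} x∈ y∈ fx≡fy =
    bij-injective (bij₁ (h₁-into x∈)) (x∈ , refl) (y∈ , sym hx≡hy) σx≡σy
    where
    hx≡hy : h₁ x ≡ h₁ y
    hx≡hy = trans (sym (proj₂ (proj₁ (f-spec x∈))))
                  (trans (cong h₂ fx≡fy) (proj₂ (proj₁ (f-spec y∈))))
    σx≡σy : σ₁ (h₁ x) x ≡ σ₁ (h₁ x) y
    σx≡σy = begin
      σ₁ (h₁ x) x       ≡⟨ sym (proj₂ (f-spec x∈)) ⟩
      σ₂ (h₁ x) (f x)   ≡⟨ cong₂ σ₂ hx≡hy fx≡fy ⟩
      σ₂ (h₁ y) (f y)   ≡⟨ proj₂ (f-spec y∈) ⟩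
      σ₁ (h₁ y) y       ≡⟨ cong (λ s → σ₁ s y) (sym hx≡hy) ⟩
      σ₁ (h₁ x) y       ∎

  f-onto : ∀ {d} → d ∈ E J₂ → ∃ λ e → e ∈ E J₁ × f e ≡ d
  f-onto {d} d∈ = x , proj₁ pre , trans (cong (λ s → partner s x) (proj₂ pre)) partner≡d
    where
    t∈ : h₂ d ∈ Ts
    t∈ = h₂-into d∈
    preimage : ∃ λ x → Pre J₁ h₁ (h₂ d) x × σ₁ (h₂ d) x ≡ σ₂ (h₂ d) d
    preimage = bij-onto (bij₁ t∈) (bij-into (bij₂ t∈) (d∈ , refl))
    x : ℕ
    x = proj₁ preimage
    pre : Pre J₁ h₁ (h₂ d) x
    pre = proj₁ (proj₂ preimage)
    spec : Pre J₂ h₂ (h₂ d) (partner (h₂ d) x) × σ₂ (h₂ d) (partner (h₂ d) x) ≡ σ₁ (h₂ d) x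
    spec = partner-spec t∈ pre
    partner≡d : partner (h₂ d) x ≡ d
    partner≡d = bij-injective (bij₂ t∈) (proj₁ spec) (d∈ , refl)
                              (trans (proj₂ spec) (proj₂ (proj₂ preimage)))

EndsMatched : {D₁ D₂ : Set} → Graph D₁ → Graph D₂ → Set
EndsMatched J₁ J₂ = ∀ {e} → e ∈ E J₁ → ∃ λ d → d ∈ E J₂ × src J₂ d ≡ src J₁ e × tgt J₂ d ≡ tgt J₁ e

covered-vertices : {D₁ D₂ : Set} (J₁ : Graph D₁) (J₂ : Graph D₂) → Covered J₁ → IsGraph J₂ →
                   EndsMatched J₁ J₂ → ∀ {v} → v ∈ V J₁ → v ∈ V J₂
covered-vertices _ J₂ covered graph₂ matched v∈ with covered v∈
... | e , e∈ , inj₁ refl =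
  let (d , d∈ , s≡ , _) = matched e∈ in subst (_∈ V J₂) s≡ (proj₁ (graph₂ d∈))
... | e , e∈ , inj₂ refl =
  let (d , d∈ , _ , t≡) = matched e∈ in subst (_∈ V J₂) t≡ (proj₂ (graph₂ d∈))

-- Part (1): two good pairs are isomorphic, by matching edges with the same
-- σ-image; the matched edges are copies of the same (t , j), so they agree.
module Uniqueness {A : Set} (C : Graph A) (ρ : QuasiRule A) (J : Graph A) (hL : ℕ → ℕ)
                  (J₁ J₂ : Graph A) (h₁ h₂ : ℕ → ℕ)
                  (good₁ : Good C ρ J hL J₁ h₁) (good₂ : Good C ρ J hL J₂ h₂) where
  open Realisation C ρ J hL
  module G₁ = GoodPair C ρ J hL J₁ h₁ good₁
  module G₂ = GoodPair C ρ J hL J₂ h₂ good₂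
  module P₁ = Patch C (PR ρ) J₁ (proj₁ good₁)
  module P₂ = Patch C (PR ρ) J₂ (proj₁ good₂)
  open FibreMatching J₁ J₂ h₁ h₂ (E (TR ρ)) (λ t → Pre J hL (τ ρ t)) G₁.σ G₂.σ
                     G₁.type-edge G₂.type-edge G₁.σ-bij G₂.σ-bij

  -- f e and e are copies of the same patch edge, hence have equal ends and label
  f-preserves : ∀ {e} → e ∈ E J₁ →
                (src J₂ (f e) ≡ src J₁ e) × (tgt J₂ (f e) ≡ tgt J₁ e) × (lab J₂ (f e) ≡ lab J₁ e)
  f-preserves {e} e∈ = realisations-agree copy₂ (G₁.realises (e∈ , refl))
    where
    copy₂ : Realises J₂ (h₁ e) (G₁.σ (h₁ e) e) (f e)
    copy₂ = subst (λ j → Realises J₂ (h₁ e) j (f e)) (proj₂ (f-spec e∈))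
                  (G₂.realises (proj₁ (f-spec e∈)))

  iso : PatchIso J₁ h₁ J₂ h₂
  iso = f , f-injective ,
        (covered-vertices J₁ J₂ P₁.covered P₂.graph forward ,
         (λ w∈ → _ , covered-vertices J₂ J₁ P₂.covered P₁.graph backward w∈ , refl) ,
         (λ e∈ → proj₁ (proj₁ (f-spec e∈))) , f-onto , f-preserves) ,
        (λ e∈ → proj₂ (proj₁ (f-spec e∈)))
    where
    forward : EndsMatched J₁ J₂
    forward e∈ = _ , proj₁ (proj₁ (f-spec e∈)) , proj₁ (f-preserves e∈) , proj₁ (proj₂ (f-preserves e∈))
    backward : EndsMatched J₂ J₁
    backward d∈ with f-onto d∈
    ... | e , e∈ , refl = e , e∈ , sym (proj₁ (f-preserves e∈)) , sym (proj₁ (proj₂ (f-preserves e∈)))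

-- Part (4): an output of the procedure is good, σ_t(e) being the patch
-- edge from which e was produced.
module ProcedureOutput {A : Set} (C : Graph A) (ρ : QuasiRule A) (J : Graph A) (hL : ℕ → ℕ)
                       (J-patch : IsPatch C (PL ρ) J) (hL-adh : IsAdhMap C (PL ρ) J (TL ρ) hL)
                       (C-PR-disjoint : Disjoint C (PR ρ))
                       (J′ : Graph A) (hR : ℕ → ℕ) (g : ℕ → ℕ → ℕ)
                       (output : ProcOutput C ρ J hL J′ hR g) where
  open Realisation C ρ J hL
  open Cases ρ
  private
    module R = PatchType (PR ρ) (TR ρ) (TR-type ρ)
    module L = PatchType (PL ρ) (TL ρ) (TL-type ρ)
    open Adherence C (PL ρ) J (TL ρ) hL (TL-type ρ) J-patch hL-adh

  generated : ∀ {d} → d ∈ E J′ → ∃ λ t → ∃ λ j → Pair ρ J hL t j × g t j ≡ d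
  generated = proj₁ output

  g-injective : ∀ {t j t′ j′} → Pair ρ J hL t j → Pair ρ J hL t′ j′ →
                g t j ≡ g t′ j′ → t ≡ t′ × j ≡ j′
  g-injective = proj₂ (proj₂ (proj₂ output))

  added∈ : ∀ {t j} → Pair ρ J hL t j → g t j ∈ E J′
  added∈ p with proj₁ (proj₂ (proj₂ output)) p
  ... | g∈ , _ = g∈

  added-fresh : ∀ {t j} → Pair ρ J hL t j → g t j ∉ E C × g t j ∉ E (PR ρ)
  added-fresh p with proj₁ (proj₂ (proj₂ output)) p
  ... | _ , ∉C , ∉PR , _ = ∉C , ∉PR

  added-ends∈ : ∀ {t j} → Pair ρ J hL t j → src J′ (g t j) ∈ V J′ × tgt J′ (g t j) ∈ V J′
  added-ends∈ p with proj₁ (proj₂ (proj₂ output)) p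
  ... | _ , _ , _ , s∈ , t∈ , _ = s∈ , t∈

  typed : ∀ {t j} → Pair ρ J hL t j → hR (g t j) ≡ t
  typed p with proj₁ (proj₂ (proj₂ output)) p
  ... | _ , _ , _ , _ , _ , hR≡ , _ = hR≡

  added-label : ∀ {t j} → Pair ρ J hL t j → lab J′ (g t j) ≡ lab J j
  added-label p with proj₁ (proj₂ (proj₂ output)) p
  ... | _ , _ , _ , _ , _ , _ , lab≡ , _ = lab≡

  added-ends : ∀ {t j} → Pair ρ J hL t j → ∀ i → CaseCond ρ t i →
               (src J′ (g t j) , tgt J′ (g t j)) ≡ CaseEnds ρ J t j i
  added-ends p with proj₁ (proj₂ (proj₂ output)) p
  ... | _ , _ , _ , _ , _ , _ , _ , ends≡ = ends≡

  module _ {t j : ℕ} (p : Pair ρ J hL t j) where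
    private
      t∈ : t ∈ E (TR ρ)
      t∈ = proj₁ p
      j∈ : j ∈ E J
      j∈ = proj₁ (proj₂ p)
      j-over : hL j ≡ τ ρ t
      j-over = proj₂ (proj₂ p)

    src-from-type : src (TR ρ) t ≢ □ → SrcSpec t j (src (TR ρ) t)
    src-from-type s≢□ = via-type s≢□ refl

    tgt-from-type : tgt (TR ρ) t ≢ □ → TgtSpec t j (tgt (TR ρ) t)
    tgt-from-type t≢□ = via-type t≢□ refl

    src-is-context : src (TL ρ) (τ ρ t) ≡ □ → src J j ∈ V C × Cxt J (TL ρ) hL j (src J j)
    src-is-context τs□ = src-in-context j∈ s□ , inj₁ (s□ , refl)
      where
      s□ : src (TL ρ) (hL j) ≡ □
      s□ = trans (cong (src (TL ρ)) j-over) τs□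

    tgt-is-context : tgt (TL ρ) (τ ρ t) ≡ □ → tgt J j ∈ V C × Cxt J (TL ρ) hL j (tgt J j)
    tgt-is-context τt□ = tgt-in-context j∈ t□ , inj₂ (s≢□ , t□ , refl)
      where
      t□ : tgt (TL ρ) (hL j) ≡ □
      t□ = trans (cong (tgt (TL ρ)) j-over) τt□
      s≢□ : src (TL ρ) (hL j) ≢ □
      s≢□ s□ = L.not-both-□ (proj₁ (hL-adh j∈)) s□ t□

    realises : Realises J′ t j (g t j)
    realises = by-case (caseOf t) (caseOf-holds t∈)
      where
      copy : ∀ i → CaseCond ρ t i → SrcSpec t j (proj₁ (CaseEnds ρ J t j i)) →
             TgtSpec t j (proj₂ (CaseEnds ρ J t j i)) → Realises J′ t j (g t j)
      copy i c sv tw = realises-at (added-ends p i c) sv tw (added-label p)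
      by-case : ∀ i → CaseCond ρ t i → Realises J′ t j (g t j)
      by-case zero c@(s≢□ , t≢□) =
        copy zero c (src-from-type s≢□) (tgt-from-type t≢□)
      by-case i@(suc zero) c@(s□ , τs□) =
        let (jC , cx) = src-is-context τs□ in
        copy i c (via-context s□ jC cx) (tgt-from-type (R.not-both-□ t∈ s□))
      by-case i@(suc (suc zero)) c@(t□ , τt□) =
        let (jC , cx) = tgt-is-context τt□ in
        copy i c (src-from-type (λ s□ → R.not-both-□ t∈ s□ t□)) (via-context t□ jC cx)
      by-case i@(suc (suc (suc zero))) c@(s□ , τt□) =
        let (jC , cx) = tgt-is-context τt□ in
        copy i c (via-context s□ jC cx) (tgt-from-type (R.not-both-□ t∈ s□))
      by-case i@(suc (suc (suc (suc zero)))) c@(t□ , τs□) =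
        let (jC , cx) = src-is-context τs□ in
        copy i c (src-from-type (λ s□ → R.not-both-□ t∈ s□ t□)) (via-context t□ jC cx)

  origin : ℕ → ℕ → ℕ
  origin t e = first (λ j → (g t j ≟ e) ×-dec (hL j ≟ τ ρ t)) (E J)

  origin-spec : ∀ {t e} → Pre J′ hR t e → Pair ρ J hL t (origin t e) × g t (origin t e) ≡ e
  origin-spec {t} {e} (e∈ , he) with generated e∈
  ... | _ , _ , p@(t∈ , j∈ , over) , refl with trans (sym (typed p)) he
  ... | refl =
    let (o∈ , go≡ , o-over) = first-spec (λ j → (g t j ≟ e) ×-dec (hL j ≟ τ ρ t)) j∈ (refl , over)
    in (t∈ , o∈ , o-over) , go≡

  is-patch : IsPatch C (PR ρ) J′
  is-patch = C-PR-disjoint , graph , fresh , proj₁ (proj₂ output) , shape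
    where
    graph : IsGraph J′
    graph d∈ with generated d∈
    ... | _ , _ , p , refl = added-ends∈ p
    fresh : ∀ {d} → d ∈ E J′ → d ∉ E C × d ∉ E (PR ρ)
    fresh d∈ with generated d∈
    ... | _ , _ , p , refl = added-fresh p
    shape : ∀ {d} → d ∈ E J′ → Shape C (PR ρ) (src J′ d) (tgt J′ d)
    shape d∈ with generated d∈
    ... | _ , _ , p , refl = realiser-shape C-PR-disjoint (proj₁ p) (realises p)

  adherent : IsAdhMap C (PR ρ) J′ (TR ρ) hR
  adherent d∈ with generated d∈
  ... | t , _ , p , refl = subst (_∈ E (TR ρ)) (sym (typed p)) (proj₁ p) ,
                           subst (Adheres C (PR ρ) J′ (TR ρ) _) (sym (typed p))
                                 (realiser-adheres C-PR-disjoint (proj₁ p) (realises p))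

  matching : ∀ {t} → t ∈ E (TR ρ) → Matching ρ J hL J′ hR t (origin t)
  matching {t} t∈ = (into , injective , onto) , label-cxt
    where
    into : ∀ {e} → Pre J′ hR t e → Pre J hL (τ ρ t) (origin t e)
    into pre = let ((_ , o∈ , over) , _) = origin-spec pre in o∈ , over
    injective : ∀ {x y} → Pre J′ hR t x → Pre J′ hR t y → origin t x ≡ origin t y → x ≡ y
    injective px py o≡ =
      trans (sym (proj₂ (origin-spec px))) (trans (cong (g t) o≡) (proj₂ (origin-spec py)))
    onto : ∀ {j} → Pre J hL (τ ρ t) j → ∃ λ e → Pre J′ hR t e × origin t e ≡ j
    onto (j∈ , over) =
      let p = (t∈ , j∈ , over) ; pre = (added∈ p , typed p) ; (q , gq) = origin-spec pre
      in g t _ , pre , proj₂ (g-injective q p gq)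
    label-cxt : ∀ {e} → Pre J′ hR t e →
                (lab J′ e ≡ lab J (origin t e)) ×
                (∀ v → Cxt J′ (TR ρ) hR e v → Cxt J (TL ρ) hL (origin t e) v)
    label-cxt {e} pre@(_ , he) = Realises.label copy , λ v → realiser-cxt hR he copy
      where
      copy : Realises J′ t (origin t e) e
      copy = subst (Realises J′ t (origin t e)) (proj₂ (origin-spec pre)) (realises (proj₁ (origin-spec pre)))

  good : Good C ρ J hL J′ hR
  good = is-patch , adherent , λ t∈ → _ , matching t∈

-- The copy of j at t is named
-- j + (t+1)·N with N above every edge name of C, P_R and J; names are
-- then fresh, and t and j are recovered by division with remainder.
module Construction {A : Set} (C : Graph A) (ρ : QuasiRule A) (J : Graph A) (hL : ℕ → ℕ) where
  open Cases ρ
  open ≡-Reasoning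

  used : List ℕ
  used = E C ++ E (PR ρ) ++ E J

  N : ℕ
  N = suc (max 0 used)

  used<N : ∀ {x} → x ∈ used → x < N
  used<N x∈ = s≤s (All.lookup (xs≤max 0 used) x∈)

  code : ℕ → ℕ → ℕ
  code t j = j + suc t * N

  typeOf : ℕ → ℕ
  typeOf d = pred (d / N)

  slotOf : ℕ → ℕ
  slotOf d = d % N

  decode-code : ∀ t {j} → j < N → typeOf (code t j) ≡ t × slotOf (code t j) ≡ j
  decode-code t {j} j<N = cong pred quotient , trans ([m+kn]%n≡m%n j (suc t) N) (m<n⇒m%n≡m j<N)
    where
    quotient : code t j / N ≡ suc t
    quotient = begin
      (j + suc t * N) / N      ≡⟨ +-distrib-/-∣ʳ j {suc t * N} {N} (n∣m*n (suc t)) ⟩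
      j / N + suc t * N / N    ≡⟨ zero-plus (m<n⇒m/n≡0 j<N) (m*n/n≡m (suc t) N) ⟩
      suc t                    ∎
      where
      zero-plus : ∀ {a b c} → a ≡ 0 → b ≡ c → a + b ≡ c
      zero-plus refl refl = refl

  code-fresh : ∀ t j {x} → x ∈ used → x < code t j
  code-fresh t j x∈ = ≤-trans (used<N x∈) (≤-trans (m≤m+n N (t * N)) (m≤n+m (suc t * N) j))

  matched? : Decidable (λ (q : ℕ × ℕ) → hL (proj₂ q) ≡ τ ρ (proj₁ q))
  matched? (t , j) = hL j ≟ τ ρ t

  pairs : List (ℕ × ℕ)
  pairs = filter matched? (cartesianProduct (E (TR ρ)) (E J))

  pair∈ : ∀ {t j} → Pair ρ J hL t j → (t , j) ∈ pairs
  pair∈ (t∈ , j∈ , over) = ∈-filter⁺ matched? (∈-cartesianProduct⁺ t∈ j∈) over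

  ∈pairs : ∀ {t j} → (t , j) ∈ pairs → Pair ρ J hL t j
  ∈pairs q∈ =
    let (tj∈ , over) = ∈-filter⁻ matched? {xs = cartesianProduct (E (TR ρ)) (E J)} q∈
        (t∈ , j∈) = ∈-cartesianProduct⁻ (E (TR ρ)) (E J) tj∈
    in t∈ , j∈ , over

  slot<N : ∀ {t j} → Pair ρ J hL t j → j < N
  slot<N (_ , j∈ , _) = used<N (∈-++⁺ʳ (E C) (∈-++⁺ʳ (E (PR ρ)) j∈))

  ends : ℕ → ℕ × ℕ
  ends d = CaseEnds ρ J (typeOf d) (slotOf d) (caseOf (typeOf d))

  new-edges : List ℕ
  new-edges = map (λ q → code (proj₁ q) (proj₂ q)) pairs

  J′ : Graph A
  J′ = mkGraph (map (proj₁ ∘ ends) new-edges ++ map (proj₂ ∘ ends) new-edges) new-edges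
               (proj₁ ∘ ends) (proj₂ ∘ ends) (lab J ∘ slotOf)

  code∈ : ∀ {t j} → Pair ρ J hL t j → code t j ∈ new-edges
  code∈ p = ∈-map⁺ (λ q → code (proj₁ q) (proj₂ q)) (pair∈ p)

  code-injective : ∀ {t j t′ j′} → Pair ρ J hL t j → Pair ρ J hL t′ j′ →
                   code t j ≡ code t′ j′ → t ≡ t′ × j ≡ j′
  code-injective p p′ eq =
    let (type≡ , slot≡) = decode-code _ (slot<N p) ; (type≡′ , slot≡′) = decode-code _ (slot<N p′)
    in trans (sym type≡) (trans (cong typeOf eq) type≡′) ,
       trans (sym slot≡) (trans (cong slotOf eq) slot≡′)

  code-avoids : ∀ t j → code t j ∉ E C × code t j ∉ E (PR ρ)
  code-avoids t j = (λ ∈C → <-irrefl refl (code-fresh t j (∈-++⁺ˡ ∈C))) ,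
                    (λ ∈PR → <-irrefl refl (code-fresh t j (∈-++⁺ʳ (E C) (∈-++⁺ˡ ∈PR))))

  ends∈ : ∀ {d} → d ∈ new-edges → src J′ d ∈ V J′ × tgt J′ d ∈ V J′
  ends∈ d∈ = ∈-++⁺ˡ (∈-map⁺ (proj₁ ∘ ends) d∈) , ∈-++⁺ʳ _ (∈-map⁺ (proj₂ ∘ ends) d∈)

  generated : ∀ {d} → d ∈ new-edges → ∃ λ t → ∃ λ j → Pair ρ J hL t j × code t j ≡ d
  generated d∈ with ∈-map⁻ (λ q → code (proj₁ q) (proj₂ q)) d∈
  ... | (t , j) , q∈ , refl = t , j , ∈pairs q∈ , refl

  covered : Covered J′
  covered v∈ with ∈-++⁻ (map (proj₁ ∘ ends) new-edges) v∈
  ... | inj₁ v∈src = let (d , d∈ , v≡) = ∈-map⁻ (proj₁ ∘ ends) v∈src in d , d∈ , inj₁ (sym v≡)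
  ... | inj₂ v∈tgt = let (d , d∈ , v≡) = ∈-map⁻ (proj₂ ∘ ends) v∈tgt in d , d∈ , inj₂ (sym v≡)

  ends-in-case : ∀ {t j} → Pair ρ J hL t j → ∀ i → CaseCond ρ t i →
                 ends (code t j) ≡ CaseEnds ρ J t j i
  ends-in-case {t} p i c
    rewrite proj₁ (decode-code t (slot<N p)) | proj₂ (decode-code t (slot<N p))
          | case-unique (proj₁ p) i (caseOf t) c (caseOf-holds (proj₁ p)) = refl

  output : ProcOutput C ρ J hL J′ typeOf code
  output = generated , covered ,
           (λ {t} {j} p → code∈ p , proj₁ (code-avoids t j) , proj₂ (code-avoids t j) ,
                      proj₁ (ends∈ (code∈ p)) , proj₂ (ends∈ (code∈ p)) ,
                      proj₁ (decode-code t (slot<N p)) , cong (lab J) (proj₂ (decode-code t (slot<N p))) ,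
                      ends-in-case p) ,
           code-injective

-- The argument works for every quasi rule
-- ρ and every C.
lemma1 : {k : ℕ} (R : QuasiRule (Fin (suc k)) → Set) (C : Graph (Fin (suc k)))
         (ρ : QuasiRule (Fin (suc k))) (J : Graph (Fin (suc k))) (hL : ℕ → ℕ) →
         IsGraph C → InClosure R ρ → IsPatch C (PL ρ) J → IsAdhMap C (PL ρ) J (TL ρ) hL →
         Disjoint C (PR ρ) →
         ((J₁ J₂ : Graph (Fin (suc k))) (h₁ h₂ : ℕ → ℕ) →
            Good C ρ J hL J₁ h₁ → Good C ρ J hL J₂ h₂ → PatchIso J₁ h₁ J₂ h₂) ×
         (∀ {t j} → Pair ρ J hL t j → ExactlyOne (CaseCond ρ t)) ×
         (Σ (Graph (Fin (suc k))) λ J' → Σ (ℕ → ℕ) λ hR → Σ (ℕ → ℕ → ℕ) λ g →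
            ProcOutput C ρ J hL J' hR g) ×
         ((J' : Graph (Fin (suc k))) (hR : ℕ → ℕ) (g : ℕ → ℕ → ℕ) →
            ProcOutput C ρ J hL J' hR g → Good C ρ J hL J' hR)
lemma1 R C ρ J hL _ _ J-patch hL-adh C-PR-disjoint =
  (λ J₁ J₂ h₁ h₂ good₁ good₂ → Uniqueness.iso C ρ J hL J₁ J₂ h₁ h₂ good₁ good₂) ,
  (λ p → Cases.exactly-one ρ (proj₁ p)) ,
  (Construction.J′ C ρ J hL , Construction.typeOf C ρ J hL , Construction.code C ρ J hL ,
   Construction.output C ρ J hL) ,
  (λ J′ hR g output → ProcedureOutput.good C ρ J hL J-patch hL-adh C-PR-disjoint J′ hR g output)
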